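{- Let $G$ be a König--Egerváry graph, let $I$ be a maximum critical independent set of $G$, and let $M$ be a maximum matching of $G$. Then \[ \mathrm{nucleus}(G)=M\bigl(N(I)-\mathrm{corona}(G)\bigr)\cup\ker(G). \]
   Context: All graphs are finite and simple. A graph $G$ is König--Egerváry if $\alpha(G)+\mu(G)=|V(G)|$, where $\alpha$ is the independence number and $\mu$ the matching number. For $X\subseteq V(G)$, $N(X)$ is the union of neighborhoods of the vertices of $X$. $\mathrm{corona}(G)$ is the union of all maximum independent sets of $G$. An independent set $I$ is critical if $|I|-|N(I)|\ge|J|-|N(J)|$ for every independent set $J$; a maximum critical independent set is a critical independent set of maximum cardinality among critical independent sets. $\ker(G)$ is the intersection of all critical independent sets, and $\mathrm{nucleus}(G)$ the intersection of all maximum critical independent sets. For a matching $M$, $M(v)=u$ if $uv\in M$ and $M(v)=v$ otherwise; $M(S)=\{M(v):v\in S\}$. -}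

module Defs where

open import Data.Nat using (ℕ; _≤_; _+_)
open import Data.Bool using (Bool; true; false; T)
open import Data.Integer as ℤ using (ℤ; +_; _-_)
open import Data.Fin using (Fin)
open import Data.Fin.Subset using (Subset; _∈_; ∣_∣)
open import Data.Fin.Subset.Properties using (_∈?_)
open import Data.Fin.Properties using (any?)
open import Data.Vec using (tabulate)
open import Data.List using (List; length; concatMap; _∷_; [])
open import Data.List.Membership.Propositional renaming (_∈_ to _∈ₗ_)
open import Data.List.Relation.Unary.All using (All)
open import Data.List.Relation.Unary.Unique.Propositional using (Unique)
open import Data.Product using (Σ; ∃; ∃-syntax; _×_; _,_)
open import Data.Sum using (_⊎_)
open import Relation.Nullary using (¬_; Dec)
open import Relation.Nullary.Decidable using (⌊_⌋; _×-dec_)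
open import Relation.Binary.PropositionalEquality using (_≡_)
open import Data.Bool.Properties using () renaming (_≟_ to _≟ᵇ_)

record Graph (n : ℕ) : Set where
  field
    adj    : Fin n → Fin n → Bool
    sym    : ∀ u v → adj u v ≡ adj v u
    irrefl : ∀ v → adj v v ≡ false
open Graph public

module _ {n : ℕ} (G : Graph n) where

  Independent : Subset n → Set
  Independent S = ∀ u v → u ∈ S → v ∈ S → adj G u v ≡ false

  N : Subset n → Subset n
  N X = tabulate λ v → ⌊ any? (λ u → (u ∈? X) ×-dec (adj G u v ≟ᵇ true)) ⌋

  MaximumIndependent : Subset n → Set
  MaximumIndependent S = Independent S × (∀ J → Independent J → ∣ J ∣ ≤ ∣ S ∣)

  IsIndependenceNumber : ℕ → Set
  IsIndependenceNumber a = (∃[ S ] (Independent S × ∣ S ∣ ≡ a))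
                         × (∀ J → Independent J → ∣ J ∣ ≤ a)

  endpoints : List (Fin n × Fin n) → List (Fin n)
  endpoints = concatMap (λ { (u , v) → u ∷ v ∷ [] })

  IsMatching : List (Fin n × Fin n) → Set
  IsMatching M = All (λ { (u , v) → adj G u v ≡ true }) M × Unique (endpoints M)

  MaximumMatching : List (Fin n × Fin n) → Set
  MaximumMatching M = IsMatching M × (∀ M' → IsMatching M' → length M' ≤ length M)

  IsMatchingNumber : ℕ → Set
  IsMatchingNumber m = (∃[ M ] (IsMatching M × length M ≡ m))
                     × (∀ M' → IsMatching M' → length M' ≤ m)

  KonigEgervary : Set
  KonigEgervary = ∃[ a ] ∃[ m ] (IsIndependenceNumber a × IsMatchingNumber m × a + m ≡ n)

  corona : Fin n → Set
  corona x = ∃[ S ] (MaximumIndependent S × x ∈ S)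

  Critical : Subset n → Set
  Critical I = Independent I ×
    (∀ J → Independent J → (+ ∣ J ∣) - (+ ∣ N J ∣) ℤ.≤ (+ ∣ I ∣) - (+ ∣ N I ∣))

  MaximumCritical : Subset n → Set
  MaximumCritical I = Critical I × (∀ J → Critical J → ∣ J ∣ ≤ ∣ I ∣)

  ker : Fin n → Set
  ker x = ∀ S → Critical S → x ∈ S

  nucleus : Fin n → Set
  nucleus x = ∀ S → MaximumCritical S → x ∈ S

  -- M(v) = x  (M(v) = u if uv ∈ M, M(v) = v if v is unmatched)
  MapsTo : List (Fin n × Fin n) → Fin n → Fin n → Set
  MapsTo M v x = ((v , x) ∈ₗ M ⊎ (x , v) ∈ₗ M) ⊎ (¬ (v ∈ₗ endpoints M) × x ≡ v)

  image : List (Fin n × Fin n) → (Fin n → Set) → Fin n → Set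
  image M X x = ∃[ v ] (X v × MapsTo M v x)

{-# OPTIONS --safe #-}

-- Fix a maximum matching M and call an independent set S tight when |V ∖ S| ≤ |M|;
-- the König–Egerváry property says that a tight set exists. Cardinalities are compared
-- through the involution v ↦ M(v), a permutation of the vertices. Since
-- each edge of M has an endpoint outside any independent set, a tight S is a maximum
-- independent set and M maps V ∖ S into S. For an independent J, M then injects
-- J ∖ S into N(J) ∩ S and V ∖ (S ∪ N(J)) into S ∖ J, which yields
-- |J| - |N(J)| ≤ |S| - |N(S)|: tight sets are critical, and a vertex of S left unmatched
-- by M lies in every critical set. Hence the maximum critical sets are exactly the maximum
-- independent sets. A vertex x of the nucleus is then either unmatched, and so in ker(G),
-- or equal to M(M(x)) with M(x) ∈ N(I) in no maximum independent set; conversely M sends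
-- a vertex outside the corona into every maximum independent set.

module Submission where

open import Defs hiding (sym)
open import Data.Nat using (ℕ; suc; _+_; _∸_; _≤_; _<_; s≤s; z≤n)
open import Data.Nat.Properties
  using (+-suc; ≤-trans; ≤-reflexive; <⇒≱; ≮⇒≥; +-mono-<; +-monoˡ-≤; +-monoʳ-≤; +-monoʳ-<;
         +-cancelˡ-≤; +-cancelʳ-≤; +-cancelʳ-<; ≤-<-trans; +-comm; m+n∸m≡n;
         +-0-commutativeMonoid; module ≤-Reasoning)
open import Data.Nat.Solver using (module +-*-Solver)
open import Data.Integer as ℤ using (+_; _⊖_)
open import Data.Integer.Properties
  using ([+m]-[+n]≡m⊖n; +-cancelˡ-⊖; ⊖-monoˡ-≤; ⊖-monoˡ-<)
  renaming (<⇒≱ to <⇒≱ᶻ)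
open import Data.Bool using (true; false; if_then_else_)
open import Data.Bool.Properties using (T-≡)
open import Data.Fin using (Fin; _≟_)
open import Data.Fin.Permutation using (Permutation′; permutation; _⟨$⟩ʳ_; _⟨$⟩ˡ_; inverseʳ)
open import Data.Fin.Subset using (Subset; _∈_; _∉_; _⊆_; _∩_; ∁; _-_; ∣_∣)
open import Data.Fin.Subset.Properties
  using (_∈?_; p⊆q⇒∣p∣≤∣q∣; p⊂q⇒∣p∣<∣q∣; x∈p⇒∣p-x∣<∣p∣; x∈p∧x≢y⇒x∈p-y; x∈p∩q⁺; x∈p∩q⁻;
         x∉p⇒x∈∁p; x∈∁p⇒x∉p; ∣p∩q∣≤∣q∣; ∩-comm; ∣∁p∣≡n∸∣p∣)
open import Data.Vec using ([]; _∷_; tabulate; lookup)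
open import Data.Vec.Properties using (lookup∘tabulate; []=⇒lookup; lookup⇒[]=)
open import Data.List using (List; []; _∷_; length)
open import Data.List.Membership.Propositional using () renaming (_∈_ to _∈ₗ_; _∉_ to _∉ₗ_)
open import Data.List.Relation.Unary.Any using (here; there)
open import Data.List.Relation.Unary.All as All using (All; []; _∷_)
open import Data.List.Relation.Unary.AllPairs using ([]; _∷_)
open import Data.List.Relation.Unary.Unique.Propositional using (Unique)
open import Data.Product using (∃-syntax; _×_; _,_; proj₁; proj₂)
open import Data.Sum using (_⊎_; inj₁; inj₂; [_,_]′; swap)
open import Function using (_∘_)
open import Function.Bundles using (_⇔_; mk⇔; Equivalence)
open import Relation.Nullary using (¬_; yes; no; contradiction; does)
open import Relation.Nullary.Decidable using (⌊_⌋; toWitness; fromWitness; dec-true; dec-false)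
open import Relation.Unary using (Pred; Decidable)
open import Relation.Binary.PropositionalEquality
  using (_≡_; refl; sym; trans; cong; cong₂; subst; subst₂; _≢_; ≢-sym; module ≡-Reasoning)
open import Algebra.Properties.CommutativeMonoid.Sum +-0-commutativeMonoid
  using (sum; sum-cong-≗; sum-permute)

-- Counting subsets of Fin n

module _ {n : ℕ} where

  ∈-tabulate : ∀ {f} {x : Fin n} → x ∈ tabulate f ⇔ (f x ≡ true)
  ∈-tabulate {f} {x} = mk⇔
    (λ x∈ → trans (sym (lookup∘tabulate f x)) ([]=⇒lookup x∈))
    (λ fx → lookup⇒[]= x _ (trans (lookup∘tabulate f x) fx))

  ∈-tabulate-⌊⌋ : ∀ {ℓ} {P : Pred (Fin n) ℓ} {P? : Decidable P} {x} →
                  x ∈ tabulate (λ v → ⌊ P? v ⌋) ⇔ P x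
  ∈-tabulate-⌊⌋ = mk⇔
    (λ x∈ → toWitness (Equivalence.from T-≡ (Equivalence.to ∈-tabulate x∈)))
    (λ px → Equivalence.from ∈-tabulate (Equivalence.to T-≡ (fromWitness px)))

∣p∩q∣+∣p∩∁q∣≡∣p∣ : ∀ {n} (p q : Subset n) → ∣ p ∩ q ∣ + ∣ p ∩ ∁ q ∣ ≡ ∣ p ∣
∣p∩q∣+∣p∩∁q∣≡∣p∣ []           []          = refl
∣p∩q∣+∣p∩∁q∣≡∣p∣ (true  ∷ p) (true  ∷ q) = cong suc (∣p∩q∣+∣p∩∁q∣≡∣p∣ p q)
∣p∩q∣+∣p∩∁q∣≡∣p∣ (true  ∷ p) (false ∷ q) =
  trans (+-suc ∣ p ∩ q ∣ _) (cong suc (∣p∩q∣+∣p∩∁q∣≡∣p∣ p q))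
∣p∩q∣+∣p∩∁q∣≡∣p∣ (false ∷ p) (_     ∷ q) = ∣p∩q∣+∣p∩∁q∣≡∣p∣ p q

∣p∣+∣∁p∣≡n : ∀ {n} (p : Subset n) → ∣ p ∣ + ∣ ∁ p ∣ ≡ n
∣p∣+∣∁p∣≡n []          = refl
∣p∣+∣∁p∣≡n (true  ∷ p) = cong suc (∣p∣+∣∁p∣≡n p)
∣p∣+∣∁p∣≡n (false ∷ p) = trans (+-suc ∣ p ∣ _) (cong suc (∣p∣+∣∁p∣≡n p))

module _ {n : ℕ} {p q : Subset n} where

  ∣∁p∣≤∣∁q∣⇔∣q∣≤∣p∣ : ∣ ∁ p ∣ ≤ ∣ ∁ q ∣ ⇔ ∣ q ∣ ≤ ∣ p ∣
  ∣∁p∣≤∣∁q∣⇔∣q∣≤∣p∣ = mk⇔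
    (λ ∁p≤∁q → +-cancelʳ-≤ (∣ ∁ q ∣) _ _ (begin
      ∣ q ∣ + ∣ ∁ q ∣ ≡⟨ trans (∣p∣+∣∁p∣≡n q) (sym (∣p∣+∣∁p∣≡n p)) ⟩
      ∣ p ∣ + ∣ ∁ p ∣ ≤⟨ +-monoʳ-≤ (∣ p ∣) ∁p≤∁q ⟩
      ∣ p ∣ + ∣ ∁ q ∣ ∎))
    (λ q≤p → +-cancelˡ-≤ (∣ p ∣) _ _ (begin
      ∣ p ∣ + ∣ ∁ p ∣ ≡⟨ trans (∣p∣+∣∁p∣≡n p) (sym (∣p∣+∣∁p∣≡n q)) ⟩
      ∣ q ∣ + ∣ ∁ q ∣ ≤⟨ +-monoˡ-≤ (∣ ∁ q ∣) q≤p ⟩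
      ∣ p ∣ + ∣ ∁ q ∣ ∎))
    where open ≤-Reasoning

unique⇒length≤∣∣ : ∀ {n} {p : Subset n} {xs : List (Fin n)} →
                   Unique xs → All (_∈ p) xs → length xs ≤ ∣ p ∣
unique⇒length≤∣∣ []               []           = z≤n
unique⇒length≤∣∣ {p = p} {x ∷ xs} (x≢xs ∷ unique) (x∈p ∷ xs⊆p) =
  ≤-trans (s≤s (unique⇒length≤∣∣ unique xs⊆p-x)) (x∈p⇒∣p-x∣<∣p∣ x∈p)
  where
  xs⊆p-x : All (_∈ p - x) xs
  xs⊆p-x = All.zipWith (λ (x≢y , y∈p) → x∈p∧x≢y⇒x∈p-y y∈p (≢-sym x≢y)) (x≢xs , xs⊆p)

indicator : ∀ {n} → Subset n → Fin n → ℕ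
indicator p x = if lookup p x then 1 else 0

∣p∣≡sum : ∀ {n} (p : Subset n) → ∣ p ∣ ≡ sum (indicator p)
∣p∣≡sum []          = refl
∣p∣≡sum (true  ∷ p) = cong suc (∣p∣≡sum p)
∣p∣≡sum (false ∷ p) = ∣p∣≡sum p

module _ {n : ℕ} (π : Permutation′ n) where

  preimage : Subset n → Subset n
  preimage q = tabulate (lookup q ∘ (π ⟨$⟩ʳ_))

  ∈-preimage : ∀ {q x} → x ∈ preimage q ⇔ π ⟨$⟩ʳ x ∈ q
  ∈-preimage {q} {x} = mk⇔
    (λ x∈ → lookup⇒[]= _ q (Equivalence.to ∈-tabulate x∈))
    (λ πx∈ → Equivalence.from ∈-tabulate ([]=⇒lookup πx∈))

  ∣preimage∣≡∣∣ : ∀ q → ∣ preimage q ∣ ≡ ∣ q ∣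
  ∣preimage∣≡∣∣ q = begin
    ∣ preimage q ∣                     ≡⟨ ∣p∣≡sum (preimage q) ⟩
    sum (indicator (preimage q))       ≡⟨ sum-cong-≗ (cong (if_then 1 else 0) ∘ lookup∘tabulate (lookup q ∘ (π ⟨$⟩ʳ_))) ⟩
    sum (indicator q ∘ (π ⟨$⟩ʳ_))       ≡⟨ sum-permute (indicator q) π ⟨
    sum (indicator q)                  ≡⟨ ∣p∣≡sum q ⟨
    ∣ q ∣                              ∎
    where open ≡-Reasoning

  module _ {p q : Subset n} (maps : ∀ {x} → x ∈ p → π ⟨$⟩ʳ x ∈ q) where

    p⊆preimage : p ⊆ preimage q
    p⊆preimage = Equivalence.from ∈-preimage ∘ maps

    maps⇒∣p∣≤∣q∣ : ∣ p ∣ ≤ ∣ q ∣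
    maps⇒∣p∣≤∣q∣ = ≤-trans (p⊆q⇒∣p∣≤∣q∣ p⊆preimage) (≤-reflexive (∣preimage∣≡∣∣ q))

    maps∧missed⇒∣p∣<∣q∣ : ∀ {y} → y ∈ q → π ⟨$⟩ˡ y ∉ p → ∣ p ∣ < ∣ q ∣
    maps∧missed⇒∣p∣<∣q∣ {y} y∈q y′∉p = begin-strict
      ∣ p ∣                   ≤⟨ p⊆q⇒∣p∣≤∣q∣ p⊆preimage-y′ ⟩
      ∣ preimage q - (π ⟨$⟩ˡ y) ∣ <⟨ x∈p⇒∣p-x∣<∣p∣ y′∈preimage ⟩
      ∣ preimage q ∣           ≡⟨ ∣preimage∣≡∣∣ q ⟩
      ∣ q ∣                   ∎
      where
      open ≤-Reasoning
      y′∈preimage : π ⟨$⟩ˡ y ∈ preimage q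
      y′∈preimage = Equivalence.from ∈-preimage (subst (_∈ q) (sym (inverseʳ π)) y∈q)
      p⊆preimage-y′ : p ⊆ preimage q - (π ⟨$⟩ˡ y)
      p⊆preimage-y′ x∈p = x∈p∧x≢y⇒x∈p-y (p⊆preimage x∈p) (λ { refl → y′∉p x∈p })

    maps∧∣q∣≤∣p∣⇒onto : ∣ q ∣ ≤ ∣ p ∣ → ∀ {y} → y ∈ q → π ⟨$⟩ˡ y ∈ p
    maps∧∣q∣≤∣p∣⇒onto ∣q∣≤∣p∣ {y} y∈q with π ⟨$⟩ˡ y ∈? p
    ... | yes y′∈p = y′∈p
    ... | no  y′∉p = contradiction ∣q∣≤∣p∣ (<⇒≱ (maps∧missed⇒∣p∣<∣q∣ y∈q y′∉p))

+m-+n≡m+o⊖n+o : ∀ m n o → + m ℤ.- + n ≡ (m + o) ⊖ (n + o)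
+m-+n≡m+o⊖n+o m n o = begin
  + m ℤ.- + n       ≡⟨ [+m]-[+n]≡m⊖n m n ⟩
  m ⊖ n             ≡⟨ +-cancelˡ-⊖ o m n ⟨
  (o + m) ⊖ (o + n) ≡⟨ cong₂ _⊖_ (+-comm o m) (+-comm o n) ⟩
  (m + o) ⊖ (n + o) ∎
  where open ≡-Reasoning

+a-+b≤+c-+d⇔a+d≤c+b : ∀ a b c d → (+ a ℤ.- + b ℤ.≤ + c ℤ.- + d) ⇔ (a + d ≤ c + b)
+a-+b≤+c-+d⇔a+d≤c+b a b c d = mk⇔
  (λ le → ≮⇒≥ (λ gt → <⇒≱ᶻ (⊖-monoˡ-< (b + d) gt) (subst₂ ℤ._≤_ lhs rhs le)))
  (λ le → subst₂ ℤ._≤_ (sym lhs) (sym rhs) (⊖-monoˡ-≤ (b + d) le))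
  where
  lhs : + a ℤ.- + b ≡ (a + d) ⊖ (b + d)
  lhs = +m-+n≡m+o⊖n+o a b d
  rhs : + c ℤ.- + d ≡ (c + b) ⊖ (b + d)
  rhs = trans (+m-+n≡m+o⊖n+o c d b) (cong ((c + b) ⊖_) (+-comm d b))

-- Neighbourhoods and independent sets

module _ {n : ℕ} (G : Graph n) where

  ∈N⇔ : ∀ {X v} → v ∈ N G X ⇔ (∃[ u ] (u ∈ X × adj G u v ≡ true))
  ∈N⇔ = ∈-tabulate-⌊⌋

  adjacent⇒∈N : ∀ {X u v} → u ∈ X → adj G u v ≡ true → v ∈ N G X
  adjacent⇒∈N u∈X uv = Equivalence.from ∈N⇔ (_ , u∈X , uv)

  adjacent⇒∉ : ∀ {S u v} → Independent G S → u ∈ S → adj G u v ≡ true → v ∉ S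
  adjacent⇒∉ independent u∈S uv v∈S with () ← trans (sym uv) (independent _ _ u∈S v∈S)

  independent⇒N⊆∁ : ∀ {S} → Independent G S → N G S ⊆ ∁ S
  independent⇒N⊆∁ independent v∈N =
    let _ , u∈S , uv = Equivalence.to ∈N⇔ v∈N in x∉p⇒x∈∁p (adjacent⇒∉ independent u∈S uv)

-- The matching involution v ↦ M(v)

mate : ∀ {n} → List (Fin n × Fin n) → Fin n → Fin n
mate []            v = v
mate ((a , b) ∷ M) v = if does (v ≟ a) then b else if does (v ≟ b) then a else mate M v

module _ {n : ℕ} (G : Graph n) where

  open import Data.List.Membership.DecPropositional (_≟_ {n}) using () renaming (_∈?_ to _∈ₗ?_)

  Incident : List (Fin n × Fin n) → Fin n → Fin n → Set
  Incident M v w = (v , w) ∈ₗ M ⊎ (w , v) ∈ₗ M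

  mate-skip : ∀ {a b v : Fin n} M → v ≢ a → v ≢ b → mate ((a , b) ∷ M) v ≡ mate M v
  mate-skip {a} {b} {v} M v≢a v≢b rewrite dec-false (v ≟ a) v≢a | dec-false (v ≟ b) v≢b = refl

  mate-unmatched : ∀ M {v} → v ∉ₗ endpoints G M → mate M v ≡ v
  mate-unmatched []            _   = refl
  mate-unmatched ((a , b) ∷ M) v∉ =
    trans (mate-skip M (v∉ ∘ here) (v∉ ∘ there ∘ here)) (mate-unmatched M (v∉ ∘ there ∘ there))

  edge⇒endpoints : ∀ {M u w} → (u , w) ∈ₗ M → u ∈ₗ endpoints G M × w ∈ₗ endpoints G M
  edge⇒endpoints (here refl) = here refl , there (here refl)
  edge⇒endpoints (there uw∈) =
    let u∈ , w∈ = edge⇒endpoints uw∈ in there (there u∈) , there (there w∈)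

  endpoint⇒edge : ∀ M {v} → v ∈ₗ endpoints G M → ∃[ w ] Incident M v w
  endpoint⇒edge ((a , b) ∷ M) (here refl)         = b , inj₁ (here refl)
  endpoint⇒edge ((a , b) ∷ M) (there (here refl)) = a , inj₂ (here refl)
  endpoint⇒edge ((a , b) ∷ M) (there (there v∈))  =
    let w , vw = endpoint⇒edge M v∈ in w , [ inj₁ ∘ there , inj₂ ∘ there ]′ vw

  mate-edge : ∀ {M u w} → Unique (endpoints G M) → (u , w) ∈ₗ M → mate M u ≡ w × mate M w ≡ u
  mate-edge {(a , b) ∷ M} (a∉ ∷ b∉ ∷ _) (here refl)
    rewrite dec-true (a ≟ a) refl | dec-false (b ≟ a) (All.lookup a∉ (here refl) ∘ sym)
          | dec-true (b ≟ b) refl = refl , refl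
  mate-edge {(a , b) ∷ M} (a∉ ∷ b∉ ∷ unique) (there uw∈) =
    trans (skip u∈) (proj₁ (mate-edge unique uw∈)) , trans (skip w∈) (proj₂ (mate-edge unique uw∈))
    where
    u∈ : _ ∈ₗ endpoints G M
    u∈ = proj₁ (edge⇒endpoints uw∈)
    w∈ : _ ∈ₗ endpoints G M
    w∈ = proj₂ (edge⇒endpoints uw∈)
    skip : ∀ {v} → v ∈ₗ endpoints G M → mate ((a , b) ∷ M) v ≡ mate M v
    skip v∈ = mate-skip M (All.lookup a∉ (there v∈) ∘ sym) (All.lookup b∉ v∈ ∘ sym)

  length-endpoints : ∀ M → length (endpoints G M) ≡ length M + length M
  length-endpoints []      = refl
  length-endpoints (_ ∷ M) = cong suc (trans (cong suc (length-endpoints M)) (sym (+-suc _ _)))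

  module _ {M : List (Fin n × Fin n)} (isMatching : IsMatching G M) where

    mate-incident : ∀ {v w} → Incident M v w → mate M v ≡ w
    mate-incident = [ proj₁ ∘ mate-edge (proj₂ isMatching) , proj₂ ∘ mate-edge (proj₂ isMatching) ]′

    adj-incident : ∀ {v w} → Incident M v w → adj G v w ≡ true
    adj-incident         (inj₁ vw∈) = All.lookup (proj₁ isMatching) vw∈
    adj-incident {v} {w} (inj₂ wv∈) = trans (Graph.sym G v w) (All.lookup (proj₁ isMatching) wv∈)

    adj-mate : ∀ {v} → v ∈ₗ endpoints G M → adj G v (mate M v) ≡ true
    adj-mate v∈ = let w , vw = endpoint⇒edge M v∈ in
      subst (λ u → adj G _ u ≡ true) (sym (mate-incident vw)) (adj-incident vw)

    mate-involutive : ∀ v → mate M (mate M v) ≡ v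
    mate-involutive v with v ∈ₗ? endpoints G M
    ... | yes v∈ = let w , vw = endpoint⇒edge M v∈ in
      trans (cong (mate M) (mate-incident vw)) (mate-incident (swap vw))
    ... | no  v∉ = trans (cong (mate M) (mate-unmatched M v∉)) (mate-unmatched M v∉)

    mate≢⇒matched : ∀ {v} → mate M v ≢ v → v ∈ₗ endpoints G M
    mate≢⇒matched {v} σv≢v with v ∈ₗ? endpoints G M
    ... | yes v∈ = v∈
    ... | no  v∉ = contradiction (mate-unmatched M v∉) σv≢v

    MapsTo⇔mate≡ : ∀ {v x} → MapsTo G M v x ⇔ mate M v ≡ x
    MapsTo⇔mate≡ {v} {x} = mk⇔ to from
      where
      to : MapsTo G M v x → mate M v ≡ x
      to (inj₁ vx)          = mate-incident vx
      to (inj₂ (v∉ , refl)) = mate-unmatched M v∉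
      from : mate M v ≡ x → MapsTo G M v x
      from refl with v ∈ₗ? endpoints G M
      ... | yes v∈ = let w , vw = endpoint⇒edge M v∈ in
        inj₁ (subst (Incident M v) (sym (mate-incident vw)) vw)
      ... | no  v∉ = inj₂ (v∉ , mate-unmatched M v∉)

    matePermutation : Permutation′ n
    matePermutation = permutation (mate M) (mate M) mate-involutive mate-involutive

    matched : Subset n
    matched = tabulate (λ v → ⌊ v ∈ₗ? endpoints G M ⌋)

    ∈-matched : ∀ {v} → v ∈ matched ⇔ v ∈ₗ endpoints G M
    ∈-matched = ∈-tabulate-⌊⌋ {P? = _∈ₗ? endpoints G M}

    2∣M∣≤∣matched∣ : length M + length M ≤ ∣ matched ∣
    2∣M∣≤∣matched∣ = ≤-trans (≤-reflexive (sym (length-endpoints M)))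
      (unique⇒length≤∣∣ (proj₂ isMatching) (All.tabulate (Equivalence.from ∈-matched)))

    2∣M∣≤∣matched∩p∣+∣∁p∣ : ∀ p → length M + length M ≤ ∣ matched ∩ p ∣ + ∣ ∁ p ∣
    2∣M∣≤∣matched∩p∣+∣∁p∣ p = begin
      length M + length M                ≤⟨ 2∣M∣≤∣matched∣ ⟩
      ∣ matched ∣                        ≡⟨ ∣p∩q∣+∣p∩∁q∣≡∣p∣ matched p ⟨
      ∣ matched ∩ p ∣ + ∣ matched ∩ ∁ p ∣ ≤⟨ +-monoʳ-≤ (∣ matched ∩ p ∣) (∣p∩q∣≤∣q∣ matched (∁ p)) ⟩
      ∣ matched ∩ p ∣ + ∣ ∁ p ∣           ∎
      where open ≤-Reasoning

    matched∩J→∁J : ∀ {J v} → Independent G J → v ∈ matched ∩ J → mate M v ∈ ∁ J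
    matched∩J→∁J independent v∈E∩J =
      let v∈E , v∈J = x∈p∩q⁻ _ _ v∈E∩J
      in x∉p⇒x∈∁p (adjacent⇒∉ G independent v∈J (adj-mate (Equivalence.to ∈-matched v∈E)))

    ∣M∣≤∣∁J∣ : ∀ {J} → Independent G J → length M ≤ ∣ ∁ J ∣
    ∣M∣≤∣∁J∣ {J} independent = ≮⇒≥ λ ∁J<M → <⇒≱ (+-mono-< ∁J<M ∁J<M) (begin
      length M + length M         ≤⟨ 2∣M∣≤∣matched∩p∣+∣∁p∣ J ⟩
      ∣ matched ∩ J ∣ + ∣ ∁ J ∣   ≤⟨ +-monoˡ-≤ (∣ ∁ J ∣) (maps⇒∣p∣≤∣q∣ matePermutation (matched∩J→∁J independent)) ⟩
      ∣ ∁ J ∣ + ∣ ∁ J ∣           ∎)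
      where open ≤-Reasoning

-- Tight independent sets

-- With M a maximum matching of a König–Egerváry graph, these are exactly the maximum
-- independent sets.
Tight : ∀ {n} → Graph n → List (Fin n × Fin n) → Subset n → Set
Tight G M S = Independent G S × ∣ ∁ S ∣ ≤ length M

module TightSet {n : ℕ} (G : Graph n) {M : List (Fin n × Fin n)} (isMatching : IsMatching G M)
                {S : Subset n} (tight : Tight G M S) where

  private
    independent : Independent G S
    independent = proj₁ tight
    E : Subset n
    E = matched G isMatching
    σ : Permutation′ n
    σ = matePermutation G isMatching

  mate-∉⇒∈ : ∀ {t} → t ∉ S → mate M t ∈ S
  mate-∉⇒∈ t∉S =
    proj₂ (x∈p∩q⁻ E S (maps∧∣q∣≤∣p∣⇒onto σ (matched∩J→∁J G isMatching independent) ∁S≤E∩S (x∉p⇒x∈∁p t∉S)))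
    where
    open ≤-Reasoning
    M≤E∩S : length M ≤ ∣ E ∩ S ∣
    M≤E∩S = +-cancelʳ-≤ (length M) _ _ (begin
      length M + length M    ≤⟨ 2∣M∣≤∣matched∩p∣+∣∁p∣ G isMatching S ⟩
      ∣ E ∩ S ∣ + ∣ ∁ S ∣     ≤⟨ +-monoʳ-≤ (∣ E ∩ S ∣) (proj₂ tight) ⟩
      ∣ E ∩ S ∣ + length M   ∎)
    ∁S≤E∩S : ∣ ∁ S ∣ ≤ ∣ E ∩ S ∣
    ∁S≤E∩S = ≤-trans (proj₂ tight) M≤E∩S

  adj-mate-∉ : ∀ {t} → t ∉ S → adj G t (mate M t) ≡ true
  adj-mate-∉ t∉S = adj-mate G isMatching (mate≢⇒matched G isMatching λ σt≡t →
    t∉S (subst (_∈ S) σt≡t (mate-∉⇒∈ t∉S)))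

  maximum : ∀ {J} → Independent G J → ∣ J ∣ ≤ ∣ S ∣
  maximum {J} independentJ = Equivalence.to (∣∁p∣≤∣∁q∣⇔∣q∣≤∣p∣ {p = S} {q = J})
    (≤-trans (proj₂ tight) (∣M∣≤∣∁J∣ G isMatching independentJ))

  maximumIndependent : MaximumIndependent G S
  maximumIndependent = independent , λ _ → maximum

  ∣N[S]∣≤∣∁S∣ : ∣ N G S ∣ ≤ ∣ ∁ S ∣
  ∣N[S]∣≤∣∁S∣ = p⊆q⇒∣p∣≤∣q∣ (independent⇒N⊆∁ G independent)

  module _ {J : Subset n} (independentJ : Independent G J) where

    private
      NJ : Subset n
      NJ = N G J

    J∩∁S→NJ∩S : ∀ {t} → t ∈ J ∩ ∁ S → mate M t ∈ NJ ∩ S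
    J∩∁S→NJ∩S t∈ =
      let t∈J , t∈∁S = x∈p∩q⁻ _ _ t∈
          t∉S = x∈∁p⇒x∉p t∈∁S
      in x∈p∩q⁺ (adjacent⇒∈N G t∈J (adj-mate-∉ t∉S) , mate-∉⇒∈ t∉S)

    ∁S∩∁NJ→S∩∁J : ∀ {t} → t ∈ ∁ S ∩ ∁ NJ → mate M t ∈ S ∩ ∁ J
    ∁S∩∁NJ→S∩∁J {t} t∈ =
      let t∈∁S , t∈∁NJ = x∈p∩q⁻ _ _ t∈
          t∉S = x∈∁p⇒x∉p t∈∁S
          σt~t = trans (Graph.sym G (mate M t) t) (adj-mate-∉ t∉S)
      in x∈p∩q⁺ (mate-∉⇒∈ t∉S , x∉p⇒x∈∁p λ σt∈J → x∈∁p⇒x∉p t∈∁NJ (adjacent⇒∈N G σt∈J σt~t))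

    -- The last summands on each side are compared through ∁S∩∁NJ→S∩∁J: weakly for the
    -- criticality of S, strictly when S ∖ J contains a vertex left unmatched by M.
    deficiency : ∣ J ∣ + ∣ ∁ S ∣ + ∣ S ∩ ∁ J ∣ ≤ ∣ S ∣ + ∣ NJ ∣ + ∣ ∁ S ∩ ∁ NJ ∣
    deficiency = begin
      ∣ J ∣ + ∣ ∁ S ∣ + e
        ≡⟨ cong₂ (λ j s → j + s + e) (sym (∣p∩q∣+∣p∩∁q∣≡∣p∣ J S)) (sym (∣p∩q∣+∣p∩∁q∣≡∣p∣ (∁ S) NJ)) ⟩
      (a + ∣ J ∩ ∁ S ∣) + (c + d) + e
        ≤⟨ +-monoˡ-≤ e (+-monoˡ-≤ (c + d) (+-monoʳ-≤ a (maps⇒∣p∣≤∣q∣ σ J∩∁S→NJ∩S))) ⟩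
      (a + b) + (c + d) + e
        ≡⟨ solve 5 (λ a b c d e → (a :+ b) :+ (c :+ d) :+ e := (a :+ e) :+ (b :+ c) :+ d) refl a b c d e ⟩
      (a + e) + (b + c) + d
        ≡⟨ cong₂ (λ s nj → s + nj + d)
             (trans (cong (λ k → ∣ k ∣ + e) (∩-comm J S)) (∣p∩q∣+∣p∩∁q∣≡∣p∣ S J))
             (trans (cong (λ k → b + ∣ k ∣) (∩-comm (∁ S) NJ)) (∣p∩q∣+∣p∩∁q∣≡∣p∣ NJ S)) ⟩
      ∣ S ∣ + ∣ NJ ∣ + d
        ∎
      where
      open ≤-Reasoning
      open +-*-Solver
      a b c d e : ℕ
      a = ∣ J ∩ S ∣
      b = ∣ NJ ∩ S ∣
      c = ∣ ∁ S ∩ NJ ∣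
      d = ∣ ∁ S ∩ ∁ NJ ∣
      e = ∣ S ∩ ∁ J ∣

  critical : Critical G S
  critical = independent , λ J independentJ →
    Equivalence.from (+a-+b≤+c-+d⇔a+d≤c+b (∣ J ∣) (∣ N G J ∣) (∣ S ∣) (∣ N G S ∣)) (begin
      ∣ J ∣ + ∣ N G S ∣ ≤⟨ +-monoʳ-≤ (∣ J ∣) ∣N[S]∣≤∣∁S∣ ⟩
      ∣ J ∣ + ∣ ∁ S ∣   ≤⟨ +-cancelʳ-≤ _ _ _ (≤-trans (deficiency independentJ)
                             (+-monoʳ-≤ _ (maps⇒∣p∣≤∣q∣ σ (∁S∩∁NJ→S∩∁J independentJ)))) ⟩
      ∣ S ∣ + ∣ N G J ∣ ∎)
    where open ≤-Reasoning

  maximumCritical : MaximumCritical G S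
  maximumCritical = critical , λ _ criticalJ → maximum (proj₁ criticalJ)

  unmatched⇒ker : ∀ {x} → x ∈ S → x ∉ₗ endpoints G M → ker G x
  unmatched⇒ker {x} x∈S x∉ J (independentJ , criticalJ) with x ∈? J
  ... | yes x∈J = x∈J
  ... | no  x∉J = contradiction S-side (<⇒≱ J-side)
    where
    σx∉∁S∩∁NJ : mate M x ∉ ∁ S ∩ ∁ (N G J)
    σx∉∁S∩∁NJ σx∈ = x∈∁p⇒x∉p (proj₁ (x∈p∩q⁻ _ _ σx∈)) (subst (_∈ S) (sym (mate-unmatched G M x∉)) x∈S)
    J-side : ∣ J ∣ + ∣ ∁ S ∣ < ∣ S ∣ + ∣ N G J ∣
    J-side = +-cancelʳ-< _ _ _ (≤-<-trans (deficiency independentJ) (+-monoʳ-< _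
      (maps∧missed⇒∣p∣<∣q∣ σ (∁S∩∁NJ→S∩∁J independentJ) (x∈p∩q⁺ (x∈S , x∉p⇒x∈∁p x∉J)) σx∉∁S∩∁NJ)))
    S-side : ∣ S ∣ + ∣ N G J ∣ ≤ ∣ J ∣ + ∣ ∁ S ∣
    S-side = ≤-trans
      (Equivalence.to (+a-+b≤+c-+d⇔a+d≤c+b (∣ S ∣) (∣ N G S ∣) (∣ J ∣) (∣ N G J ∣)) (criticalJ S independent))
      (+-monoʳ-≤ (∣ J ∣) ∣N[S]∣≤∣∁S∣)

-- König–Egerváry graphs

module _ {n : ℕ} (G : Graph n) {M : List (Fin n × Fin n)} (maximumMatching : MaximumMatching G M) where

  konigEgervary⇒tight : KonigEgervary G → ∃[ S ] Tight G M S
  konigEgervary⇒tight (a , m , ((S , independent , ∣S∣≡a) , _) , ((M₀ , isMatching₀ , ∣M₀∣≡m) , _) , a+m≡n) =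
    S , independent , (begin
      ∣ ∁ S ∣    ≡⟨ ∣∁p∣≡n∸∣p∣ S ⟩
      n ∸ ∣ S ∣  ≡⟨ cong₂ _∸_ (sym a+m≡n) ∣S∣≡a ⟩
      a + m ∸ a  ≡⟨ m+n∸m≡n a m ⟩
      m          ≡⟨ sym ∣M₀∣≡m ⟩
      length M₀  ≤⟨ proj₂ maximumMatching M₀ isMatching₀ ⟩
      length M   ∎)
    where open ≤-Reasoning

module KonigEgervaryGraph {n : ℕ} (G : Graph n) {M : List (Fin n × Fin n)}
                          (maximumMatching : MaximumMatching G M) (konigEgervary : KonigEgervary G) where

  private
    S₀ : Subset n
    S₀ = proj₁ (konigEgervary⇒tight G maximumMatching konigEgervary)
    tight₀ : Tight G M S₀
    tight₀ = proj₂ (konigEgervary⇒tight G maximumMatching konigEgervary)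

  larger⇒tight : ∀ {S} → Independent G S → ∣ S₀ ∣ ≤ ∣ S ∣ → Tight G M S
  larger⇒tight {S} independent S₀≤S =
    independent , ≤-trans (Equivalence.from (∣∁p∣≤∣∁q∣⇔∣q∣≤∣p∣ {p = S} {q = S₀}) S₀≤S) (proj₂ tight₀)

  maximumCritical⇒tight : ∀ {S} → MaximumCritical G S → Tight G M S
  maximumCritical⇒tight ((independent , _) , maximum) =
    larger⇒tight independent (maximum _ (TightSet.critical G (proj₁ maximumMatching) tight₀))

  maximumIndependent⇒tight : ∀ {S} → MaximumIndependent G S → Tight G M S
  maximumIndependent⇒tight (independent , maximum) = larger⇒tight independent (maximum _ (proj₁ tight₀))

  nucleus⊆maximumIndependent : ∀ {x S} → nucleus G x → MaximumIndependent G S → x ∈ S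
  nucleus⊆maximumIndependent x∈nucleus maximumIndependentS =
    x∈nucleus _ (TightSet.maximumCritical G (proj₁ maximumMatching) (maximumIndependent⇒tight maximumIndependentS))

mainTheorem6 : (n : ℕ) (G : Graph n) → KonigEgervary G →
  (I : Subset n) → MaximumCritical G I →
  (M : List (Fin n × Fin n)) → MaximumMatching G M →
  (x : Fin n) →
  nucleus G x ⇔ (image G M (λ v → v ∈ N G I × ¬ corona G v) x ⊎ ker G x)
mainTheorem6 n G konigEgervary I maximumCriticalI M maximumMatching x = mk⇔ to from
  where
  open import Data.List.Membership.DecPropositional (_≟_ {n}) using () renaming (_∈?_ to _∈ₗ?_)
  open KonigEgervaryGraph G maximumMatching konigEgervary
  isMatching : IsMatching G M
  isMatching = proj₁ maximumMatching
  module T = TightSet G isMatching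

  to : nucleus G x → image G M (λ v → v ∈ N G I × ¬ corona G v) x ⊎ ker G x
  to x∈nucleus with x ∈ₗ? endpoints G M
  ... | no  x∉ = inj₂ (T.unmatched⇒ker (maximumCritical⇒tight maximumCriticalI) (x∈nucleus I maximumCriticalI) x∉)
  ... | yes x∈ = inj₁ (mate M x , (adjacent⇒∈N G (x∈nucleus I maximumCriticalI) x~σx , σx∉corona) ,
                       Equivalence.from (MapsTo⇔mate≡ G isMatching) (mate-involutive G isMatching x))
    where
    x~σx : adj G x (mate M x) ≡ true
    x~σx = adj-mate G isMatching x∈
    σx∉corona : ¬ corona G (mate M x)
    σx∉corona (S , maximumIndependentS , σx∈S) = adjacent⇒∉ G (proj₁ maximumIndependentS)
      (nucleus⊆maximumIndependent x∈nucleus maximumIndependentS) x~σx σx∈S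

  from : image G M (λ v → v ∈ N G I × ¬ corona G v) x ⊎ ker G x → nucleus G x
  from (inj₂ x∈ker) S maximumCriticalS = x∈ker S (proj₁ maximumCriticalS)
  from (inj₁ (v , (_ , v∉corona) , v↦x)) S maximumCriticalS =
    subst (_∈ S) (Equivalence.to (MapsTo⇔mate≡ G isMatching) v↦x)
      (T.mate-∉⇒∈ tightS λ v∈S → v∉corona (S , T.maximumIndependent tightS , v∈S))
    where
    tightS : Tight G M S
    tightS = maximumCritical⇒tight maximumCriticalS
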